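{- For all $n\ge 2$, $\overline{q}_n(123,132,213,231)=4$.
   Context: For a positive integer $n$, let $\mathcal{S}_{n,n}$ denote the set of all permutations (words) $\pi=\pi_1\cdots\pi_{2n}$ of the multiset $\{1,1,2,2,\ldots,n,n\}$. A word $\pi$ contains a pattern $\sigma=\sigma_1\cdots\sigma_k$ if there are indices $i_1<\cdots<i_k$ such that $\pi_{i_a}=\pi_{i_b}$ iff $\sigma_a=\sigma_b$ and $\pi_{i_a}<\pi_{i_b}$ iff $\sigma_a<\sigma_b$ for all $a,b$; otherwise $\pi$ avoids $\sigma$. The quasi-Stirling permutations $\overline{\mathcal{Q}}_n$ are the $\pi\in\mathcal{S}_{n,n}$ avoiding both $1212$ and $2121$. For a set $\Lambda$ of patterns, $\overline{\mathcal{Q}}_n(\Lambda)$ is the set of $\pi\in\overline{\mathcal{Q}}_n$ avoiding every pattern in $\Lambda$, and $\overline{q}_n(\Lambda)=|\overline{\mathcal{Q}}_n(\Lambda)|$. -}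

module Defs where

open import Data.Nat using (ℕ; suc; _<_)
open import Data.List using (List; []; _∷_; map; concatMap; upTo)
open import Data.List.Relation.Binary.Pointwise using (Pointwise)
open import Data.List.Relation.Binary.Sublist.Propositional using (_⊆_)
open import Data.List.Relation.Binary.Permutation.Propositional using (_↭_)
open import Data.List.Relation.Unary.Unique.Propositional using (Unique)
open import Data.List.Membership.Propositional using (_∈_)
open import Data.Product using (Σ; ∃; _×_)
open import Function.Bundles using (_⇔_)
open import Relation.Binary.PropositionalEquality using (_≡_)
open import Relation.Nullary using (¬_)

doubled : ℕ → List ℕ
doubled n = concatMap (λ i → i ∷ i ∷ []) (map suc (upTo n))

IsWord : ℕ → List ℕ → Set
IsWord n π = π ↭ doubled n

SameRel : ℕ → ℕ → ℕ → ℕ → Set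
SameRel x a y b = (x ≡ a ⇔ y ≡ b) × (x < a ⇔ y < b) × (a < x ⇔ b < y)

-- two equal-length sequences are order-isomorphic (all pairs of positions compare alike)
data OrdIso : List ℕ → List ℕ → Set where
  []  : OrdIso [] []
  _∷_ : ∀ {x y xs ys} → Pointwise (λ a b → SameRel x a y b) xs ys →
        OrdIso xs ys → OrdIso (x ∷ xs) (y ∷ ys)

Contains : List ℕ → List ℕ → Set
Contains π σ = ∃ λ s → (s ⊆ π) × OrdIso s σ

Avoids : List ℕ → List ℕ → Set
Avoids π σ = ¬ Contains π σ

AvoidsAll : List ℕ → List (List ℕ) → Set
AvoidsAll π [] = Data.Unit.⊤ where import Data.Unit
AvoidsAll π (σ ∷ Λ) = Avoids π σ × AvoidsAll π Λ

QuasiStirling : ℕ → List ℕ → Set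
QuasiStirling n π = IsWord n π × Avoids π (1 ∷ 2 ∷ 1 ∷ 2 ∷ []) × Avoids π (2 ∷ 1 ∷ 2 ∷ 1 ∷ [])

QuasiStirlingAvoiding : ℕ → List (List ℕ) → List ℕ → Set
QuasiStirlingAvoiding n Λ π = QuasiStirling n π × AvoidsAll π Λ

HasCard : (List ℕ → Set) → ℕ → Set
HasCard P k = Σ (List (List ℕ)) λ L →
  (Data.List.length L ≡ k) × Unique L × (∀ π → (π ∈ L) ⇔ P π)
  where import Data.List

-- Avoiding 123, 132, 213 and 231 means that in every subsequence of three distinct
-- letters the first one is the largest.  For n ≥ 3 a word of Q̄_n(123,132,213,231)
-- therefore begins with n n: a first letter x < n would be followed by n and by a
-- letter of {1, 2} other than x, and after the first n the same argument applies to
-- the second letter.  Deleting the leading n n leaves a word counted for n - 1, and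
-- conversely prepending n n creates no occurrence of 1212, 2121 or the four
-- patterns: an occurrence using a leading n would need a later letter above n or,
-- for 2121, a second n after a smaller letter.  So the count does not depend on n,
-- and for n = 2 the words 1122, 1221, 2112, 2211 are found by checking all
-- arrangements.
module Submission where

open import Defs
open import Data.Nat using (ℕ; _≤_; zero; suc; _<_; z≤n; s≤s; s<s; sz<ss; _+_)
open import Data.Nat.Properties
  using (_≟_; _<?_; ≤-refl; <⇒≤; <⇒≱; ≤∧≢⇒<; m≤n⇒m≤1+n; m<1+n⇒m≤n; <-cmp; <-irrefl)
open import Data.List using (List; []; _∷_; [_]; map; _++_; upTo; concatMap; length)
open import Data.List.Properties using (map-++; concatMap-++; upTo-∷ʳ; length-map; ≡-dec; ∷-injective)
open import Data.List.Relation.Binary.Pointwise as Pointwise using (Pointwise; []; _∷_)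
open import Data.List.Relation.Binary.Sublist.Propositional
  using (_⊆_; []; _∷_; _∷ʳ_; ⊆-refl; ⊆-trans; lookup; from∈)
open import Data.List.Relation.Binary.Sublist.Propositional.Properties using (All-resp-⊆; ∷⁻)
open import Data.List.Relation.Binary.Permutation.Propositional using (_↭_; ↭-sym; ↭-trans; prep; swap)
import Data.List.Relation.Binary.Permutation.Propositional as ↭
open import Data.List.Relation.Binary.Permutation.Propositional.Properties
  using (∈-resp-↭; ↭-length; drop-∷; drop-mid; ++-comm)
open import Data.List.Relation.Unary.Unique.Propositional using (Unique)
import Data.List.Relation.Unary.Unique.Propositional.Properties as Unique
open import Data.List.Relation.Unary.Unique.DecPropositional (≡-dec _≟_) using (unique?)
open import Data.List.Relation.Unary.All as All using (All; []; _∷_)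
open import Data.List.Relation.Unary.Any as Any using (Any; here; there)
open import Data.List.Membership.Propositional using (_∈_; find; lose)
open import Data.List.Membership.DecPropositional (≡-dec _≟_) using (_∈?_)
open import Data.List.Membership.Propositional.Properties
  using (∈-map⁺; ∈-map⁻; ∈-∃++; ∈-++⁺ˡ; ∈-++⁺ʳ; ∈-++⁻; ∈-concatMap⁺; ∈-concatMap⁻)
open import Data.Product using (∃; _×_; _,_; proj₁; proj₂; uncurry)
open import Data.Sum using (_⊎_; inj₁; inj₂)
import Data.Sum as Sum
open import Data.Empty using (⊥; ⊥-elim)
open import Data.Unit using (tt)
open import Function.Bundles using (_⇔_; mk⇔; Equivalence)
open import Relation.Binary.PropositionalEquality using (_≡_; _≢_; refl; sym; cong; cong₂; trans; module ≡-Reasoning)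
open import Function using (_∘_)
open import Relation.Nullary using (¬_; Dec; yes; no; ¬?)
open import Relation.Nullary.Decidable as Dec using (map′; _×-dec_; _→-dec_; toWitness)
open import Relation.Binary using (Tri; tri<; tri≈; tri>)

open Equivalence

private
  variable
    A : Set
    a b k n x : ℕ
    ys w π ρ σ : List ℕ

-- Enumerating permutations and sublists

insertions : A → List A → List (List A)
insertions y [] = [ [ y ] ]
insertions y (x ∷ xs) = (y ∷ x ∷ xs) ∷ map (x ∷_) (insertions y xs)

permutations : List A → List (List A)
permutations [] = [ [] ]
permutations (y ∷ ys) = concatMap (insertions y) (permutations ys)

∈insertions⇒↭ : ∀ {y : A} xs {zs} → zs ∈ insertions y xs → zs ↭ y ∷ xs
∈insertions⇒↭ [] (here refl) = ↭.refl
∈insertions⇒↭ (x ∷ xs) (here refl) = ↭.refl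
∈insertions⇒↭ (x ∷ xs) (there p) with ∈-map⁻ (x ∷_) p
... | zs , zs∈ , refl = ↭-trans (prep x (∈insertions⇒↭ xs zs∈)) (swap x _ ↭.refl)

∈-insertions : ∀ (y : A) us vs → us ++ y ∷ vs ∈ insertions y (us ++ vs)
∈-insertions y [] [] = here refl
∈-insertions y [] (v ∷ vs) = here refl
∈-insertions y (u ∷ us) vs = there (∈-map⁺ (u ∷_) (∈-insertions y us vs))

∈permutations⇔↭ : ∀ {zs : List A} ys → zs ∈ permutations ys ⇔ (zs ↭ ys)
∈permutations⇔↭ ys = mk⇔ (sound ys) (complete ys)
  where
    sound : ∀ {zs} ys → zs ∈ permutations ys → zs ↭ ys
    sound [] (here refl) = ↭.refl
    sound (y ∷ ys) p with find (∈-concatMap⁻ (insertions y) {xs = permutations ys} p)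
    ... | us , us∈ , zs∈ = ↭-trans (∈insertions⇒↭ us zs∈) (prep y (sound ys us∈))

    complete : ∀ {zs} ys → zs ↭ ys → zs ∈ permutations ys
    complete {[]} [] _ = here refl
    complete {_ ∷ _} [] p with ↭-length p
    ... | ()
    complete (y ∷ ys) p with ∈-∃++ (∈-resp-↭ (↭-sym p) (here refl))
    ... | us , vs , refl =
      ∈-concatMap⁺ (insertions y) (lose (complete ys (drop-mid us [] p)) (∈-insertions y us vs))

sublists : List A → List (List A)
sublists [] = [ [] ]
sublists (x ∷ xs) = map (x ∷_) (sublists xs) ++ sublists xs

∈sublists⇔⊆ : ∀ {xs : List A} ys → xs ∈ sublists ys ⇔ (xs ⊆ ys)
∈sublists⇔⊆ ys = mk⇔ (sound ys) complete
  where
    sound : ∀ {xs} ys → xs ∈ sublists ys → xs ⊆ ys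
    sound [] (here refl) = []
    sound (y ∷ ys) p with ∈-++⁻ (map (y ∷_) (sublists ys)) p
    ... | inj₂ q = y ∷ʳ sound ys q
    ... | inj₁ q with ∈-map⁻ (y ∷_) q
    ...   | xs , xs∈ , refl = refl ∷ sound ys xs∈

    complete : ∀ {xs ys} → xs ⊆ ys → xs ∈ sublists ys
    complete [] = here refl
    complete (y ∷ʳ s) = ∈-++⁺ʳ (map (y ∷_) _) (complete s)
    complete (refl ∷ s) = ∈-++⁺ˡ (∈-map⁺ _ (complete s))

-- Decidability of pattern containment

infix 2 _⇔-dec_
_⇔-dec_ : {P Q : Set} → Dec P → Dec Q → Dec (P ⇔ Q)
p? ⇔-dec q? = map′ (uncurry mk⇔) (λ e → to e , from e) ((p? →-dec q?) ×-dec (q? →-dec p?))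

sameRel? : ∀ x a y b → Dec (SameRel x a y b)
sameRel? x a y b = (x ≟ a ⇔-dec y ≟ b) ×-dec (x <? a ⇔-dec y <? b) ×-dec (a <? x ⇔-dec b <? y)

ordIso? : ∀ s σ → Dec (OrdIso s σ)
ordIso? [] [] = yes []
ordIso? [] (_ ∷ _) = no λ ()
ordIso? (_ ∷ _) [] = no λ ()
ordIso? (x ∷ s) (y ∷ σ) = map′ (uncurry _∷_) (λ { (p ∷ i) → p , i })
  (Pointwise.decidable (λ a b → sameRel? x a y b) s σ ×-dec ordIso? s σ)

contains? : ∀ π σ → Dec (Contains π σ)
contains? π σ = map′
  (λ a → let (s , s∈ , iso) = find a in s , to (∈sublists⇔⊆ π) s∈ , iso)
  (λ (s , s⊆ , iso) → lose (from (∈sublists⇔⊆ π) s⊆) iso)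
  (Any.any? (λ s → ordIso? s σ) (sublists π))

avoidsAll? : ∀ π Λ → Dec (AvoidsAll π Λ)
avoidsAll? π [] = yes tt
avoidsAll? π (σ ∷ Λ) = ¬? (contains? π σ) ×-dec avoidsAll? π Λ

isWord? : ∀ n π → Dec (IsWord n π)
isWord? n π = Dec.map (∈permutations⇔↭ (doubled n)) (π ∈? permutations (doubled n))

quasiStirlingAvoiding? : ∀ n Λ π → Dec (QuasiStirlingAvoiding n Λ π)
quasiStirlingAvoiding? n Λ π =
  (isWord? n π ×-dec ¬? (contains? π (1 ∷ 2 ∷ 1 ∷ 2 ∷ [])) ×-dec ¬? (contains? π (2 ∷ 1 ∷ 2 ∷ 1 ∷ [])))
  ×-dec avoidsAll? π Λ

doubled-suc↭ : ∀ n → doubled (suc n) ↭ suc n ∷ suc n ∷ doubled n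
doubled-suc↭ n = ↭-trans (↭.↭-reflexive doubled-suc) (++-comm (doubled n) (suc n ∷ suc n ∷ []))
  where
    twice : ℕ → List ℕ
    twice i = i ∷ i ∷ []

    doubled-suc : doubled (suc n) ≡ doubled n ++ twice (suc n)
    doubled-suc = begin
      concatMap twice (map suc (upTo (suc n)))        ≡⟨ cong (concatMap twice ∘ map suc) (sym (upTo-∷ʳ n)) ⟩
      concatMap twice (map suc (upTo n ++ [ n ]))     ≡⟨ cong (concatMap twice) (map-++ suc (upTo n) [ n ]) ⟩
      concatMap twice (map suc (upTo n) ++ [ suc n ]) ≡⟨ concatMap-++ twice (map suc (upTo n)) [ suc n ] ⟩
      doubled n ++ twice (suc n)                      ∎
      where open ≡-Reasoning

∈doubled⇒≤ : x ∈ doubled n → x ≤ n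
∈doubled⇒≤ {n = suc n} p with ∈-resp-↭ (doubled-suc↭ n) p
... | here refl = ≤-refl
... | there (here refl) = ≤-refl
... | there (there q) = m≤n⇒m≤1+n (∈doubled⇒≤ q)

≤⇒∈doubled : 1 ≤ x → x ≤ n → x ∈ doubled n
≤⇒∈doubled {n = zero} (s≤s _) ()
≤⇒∈doubled {x} {suc n} 1≤x x≤1+n = ∈-resp-↭ (↭-sym (doubled-suc↭ n)) x∈
  where
    x∈ : x ∈ suc n ∷ suc n ∷ doubled n
    x∈ with x ≟ suc n
    ... | yes refl = here refl
    ... | no x≢1+n = there (there (≤⇒∈doubled 1≤x (m<1+n⇒m≤n (≤∧≢⇒< x≤1+n x≢1+n))))

sameRel-< : x < a → k < b → SameRel x a k b
sameRel-< x<a k<b =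
    mk⇔ (λ { refl → ⊥-elim (<-irrefl refl x<a) }) (λ { refl → ⊥-elim (<-irrefl refl k<b) })
  , mk⇔ (λ _ → k<b) (λ _ → x<a)
  , mk⇔ (λ a<x → ⊥-elim (<⇒≱ x<a (<⇒≤ a<x))) (λ b<k → ⊥-elim (<⇒≱ k<b (<⇒≤ b<k)))

sameRel-> : a < x → b < k → SameRel x a k b
sameRel-> a<x b<k =
    mk⇔ (λ { refl → ⊥-elim (<-irrefl refl a<x) }) (λ { refl → ⊥-elim (<-irrefl refl b<k) })
  , mk⇔ (λ x<a → ⊥-elim (<⇒≱ a<x (<⇒≤ x<a))) (λ k<b → ⊥-elim (<⇒≱ b<k (<⇒≤ k<b)))
  , mk⇔ (λ _ → b<k) (λ _ → a<x)

Avoids-⊆ : ρ ⊆ π → Avoids π σ → Avoids ρ σ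
Avoids-⊆ ρ⊆π av (s , s⊆ρ , iso) = av (s , ⊆-trans s⊆ρ ρ⊆π , iso)

AvoidsAll-⊆ : ∀ {Λ} → ρ ⊆ π → AvoidsAll π Λ → AvoidsAll ρ Λ
AvoidsAll-⊆ {Λ = []} _ _ = tt
AvoidsAll-⊆ {Λ = σ ∷ Λ} ρ⊆π (av , avs) = Avoids-⊆ ρ⊆π av , AvoidsAll-⊆ ρ⊆π avs

Contains-∷⁻ : Contains (k ∷ π) (a ∷ σ) →
  Contains π (a ∷ σ) ⊎ ∃ λ s → s ⊆ π × Pointwise (λ u b → SameRel k u a b) s σ
Contains-∷⁻ (s , _ ∷ʳ s⊆ , iso) = inj₁ (s , s⊆ , iso)
Contains-∷⁻ (_ ∷ s , refl ∷ s⊆ , pw ∷ _) = inj₂ (s , s⊆ , pw)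

-- The leading pair of largest letters

firstNotLargest : List (List ℕ)
firstNotLargest = (1 ∷ 2 ∷ 3 ∷ []) ∷ (1 ∷ 3 ∷ 2 ∷ []) ∷ (2 ∷ 1 ∷ 3 ∷ []) ∷ (2 ∷ 3 ∷ 1 ∷ []) ∷ []

QSA : ℕ → List ℕ → Set
QSA n = QuasiStirlingAvoiding n firstNotLargest

⊆-ordered-pair : k ∈ ρ → b ∈ ρ → k ≢ b → k ∷ b ∷ [] ⊆ ρ ⊎ b ∷ k ∷ [] ⊆ ρ
⊆-ordered-pair (here refl) (here refl) k≢b = ⊥-elim (k≢b refl)
⊆-ordered-pair (here refl) (there b∈ρ) _ = inj₁ (refl ∷ from∈ b∈ρ)
⊆-ordered-pair (there k∈ρ) (here refl) _ = inj₂ (refl ∷ from∈ k∈ρ)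
⊆-ordered-pair (there k∈ρ) (there b∈ρ) k≢b = Sum.map (_ ∷ʳ_) (_ ∷ʳ_) (⊆-ordered-pair k∈ρ b∈ρ k≢b)

-- Whatever the relative order of x, k, b, the letters x, k, b form one of the four patterns.
leader-below-max⇒¬avoids : x < k → b < k → x ≢ b → k ∈ ρ → b ∈ ρ → x ∷ ρ ⊆ π →
  ¬ AvoidsAll π firstNotLargest
leader-below-max⇒¬avoids {x} {k} {b} {ρ} {π} x<k b<k x≢b k∈ρ b∈ρ x∷ρ⊆π (av123 , av132 , av213 , av231 , _) =
  by-order (⊆-ordered-pair k∈ρ b∈ρ (λ k≡b → <-irrefl (sym k≡b) b<k)) (<-cmp x b)
  where
    occurs : ∀ {y z σ} → y ∷ z ∷ [] ⊆ ρ → OrdIso (x ∷ y ∷ z ∷ []) σ → Contains π σ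
    occurs yz⊆ρ iso = _ , ⊆-trans (refl ∷ yz⊆ρ) x∷ρ⊆π , iso

    1<2 : 1 < 2
    1<2 = sz<ss
    1<3 : 1 < 3
    1<3 = sz<ss
    2<3 : 2 < 3
    2<3 = s<s sz<ss

    by-order : k ∷ b ∷ [] ⊆ ρ ⊎ b ∷ k ∷ [] ⊆ ρ → Tri (x < b) (x ≡ b) (b < x) → ⊥
    by-order _ (tri≈ _ x≡b _) = x≢b x≡b
    by-order (inj₁ kb) (tri< x<b _ _) = av132 (occurs kb
      ((sameRel-< x<k 1<3 ∷ sameRel-< x<b 1<2 ∷ []) ∷ (sameRel-> b<k 2<3 ∷ []) ∷ [] ∷ []))
    by-order (inj₁ kb) (tri> _ _ b<x) = av231 (occurs kb
      ((sameRel-< x<k 2<3 ∷ sameRel-> b<x 1<2 ∷ []) ∷ (sameRel-> b<k 1<3 ∷ []) ∷ [] ∷ []))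
    by-order (inj₂ bk) (tri< x<b _ _) = av123 (occurs bk
      ((sameRel-< x<b 1<2 ∷ sameRel-< x<k 1<3 ∷ []) ∷ (sameRel-< b<k 2<3 ∷ []) ∷ [] ∷ []))
    by-order (inj₂ bk) (tri> _ _ b<x) = av213 (occurs bk
      ((sameRel-> b<x 1<2 ∷ sameRel-< x<k 2<3 ∷ []) ∷ (sameRel-< b<k 1<3 ∷ []) ∷ [] ∷ []))

head≡max-by : b < k → x ≢ b → b ∈ ys → x ∷ ρ ⊆ π → AvoidsAll π firstNotLargest →
  x ∷ ρ ↭ k ∷ ys → All (_≤ k) ys → x ≡ k × ρ ↭ ys
head≡max-by {b} {k} {x} {ys} {ρ} b<k x≢b b∈ys x∷ρ⊆π av x∷ρ↭ ys≤k with x ≟ k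
... | yes refl = refl , drop-∷ x∷ρ↭
... | no x≢k = ⊥-elim (leader-below-max⇒¬avoids x<k b<k x≢b
                 (∈ρ x≢k (here refl)) (∈ρ x≢b (there b∈ys)) x∷ρ⊆π av)
  where
    ∈ρ : ∀ {y} → x ≢ y → y ∈ k ∷ ys → y ∈ ρ
    ∈ρ x≢y y∈ = Any.tail (λ y≡x → x≢y (sym y≡x)) (∈-resp-↭ (↭-sym x∷ρ↭) y∈)

    x<k : x < k
    x<k with ∈-resp-↭ x∷ρ↭ (here refl)
    ... | here x≡k = ⊥-elim (x≢k x≡k)
    ... | there x∈ys = ≤∧≢⇒< (All.lookup ys≤k x∈ys) x≢k

head≡max : 2 < k → 1 ∈ ys → 2 ∈ ys → x ∷ ρ ⊆ π → AvoidsAll π firstNotLargest →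
  x ∷ ρ ↭ k ∷ ys → All (_≤ k) ys → x ≡ k × ρ ↭ ys
head≡max {x = x} 2<k 1∈ys 2∈ys with x ≟ 1
... | yes refl = head≡max-by 2<k (λ ()) 2∈ys
... | no x≢1 = head≡max-by (<⇒≤ 2<k) x≢1 1∈ys

↭doubled⇒max∷max∷ : 2 ≤ n → π ↭ doubled (suc n) → AvoidsAll π firstNotLargest →
  ∃ λ w → π ≡ suc n ∷ suc n ∷ w × w ↭ doubled n
↭doubled⇒max∷max∷ {π = []} _ π↭ _ with ↭-length π↭
... | ()
↭doubled⇒max∷max∷ {π = _ ∷ []} _ π↭ _ with ↭-length π↭
... | ()
↭doubled⇒max∷max∷ {n} {x ∷ y ∷ w} 2≤n π↭ av =
  let x≡1+n , y∷w↭ = head≡max 2<1+n (there 1∈) (there 2∈) ⊆-refl av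
                       (↭-trans π↭ (doubled-suc↭ n)) (≤-refl ∷ doubled≤)
      y≡1+n , w↭ = head≡max 2<1+n 1∈ 2∈ (x ∷ʳ ⊆-refl) av y∷w↭ doubled≤
  in w , cong₂ (λ a b → a ∷ b ∷ w) x≡1+n y≡1+n , w↭
  where
    2<1+n : 2 < suc n
    2<1+n = s≤s 2≤n
    1∈ : 1 ∈ doubled n
    1∈ = ≤⇒∈doubled ≤-refl (<⇒≤ 2≤n)
    2∈ : 2 ∈ doubled n
    2∈ = ≤⇒∈doubled (s≤s z≤n) 2≤n
    doubled≤ : All (_≤ suc n) (doubled n)
    doubled≤ = All.tabulate (m≤n⇒m≤1+n ∘ ∈doubled⇒≤)

-- Prepending a pair of new largest letters

LedBySmaller : List ℕ → Set
LedBySmaller [] = ⊥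
LedBySmaller (a ∷ σ) = Any (a <_) σ

firstNotLargest-ledBySmaller : All LedBySmaller firstNotLargest
firstNotLargest-ledBySmaller = here sz<ss ∷ here sz<ss ∷ there (here (s<s sz<ss)) ∷ here (s<s sz<ss) ∷ []

-- The new letter k cannot play the role of a, which is followed by a larger pattern letter.
avoids-∷-above : All (_≤ k) w → Any (a <_) σ → Avoids w (a ∷ σ) → Avoids (k ∷ w) (a ∷ σ)
avoids-∷-above {k} {w} {a} w≤k a<σ av =
  Sum.[ av , (λ (s , s⊆w , pw) → no-larger (All-resp-⊆ s⊆w w≤k) pw a<σ) ]′ ∘ Contains-∷⁻
  where
    no-larger : ∀ {s σ} → All (_≤ k) s → Pointwise (λ u b → SameRel k u a b) s σ → Any (a <_) σ → ⊥
    no-larger (u≤k ∷ _) (r ∷ _) (here a<b) = <⇒≱ (from (proj₁ (proj₂ r)) a<b) u≤k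
    no-larger (_ ∷ s≤k) (_ ∷ pw) (there a<σ) = no-larger s≤k pw a<σ

avoids-∷∷-above : All (_< k) w → Any (a <_) σ → Avoids w (a ∷ σ) → Avoids (k ∷ k ∷ w) (a ∷ σ)
avoids-∷∷-above {k} {w} w<k a<σ av = avoids-∷-above (≤-refl ∷ w≤k) a<σ (avoids-∷-above w≤k a<σ av)
  where
    w≤k : All (_≤ k) w
    w≤k = All.map <⇒≤ w<k

avoidsAll-∷∷-above : ∀ {Λ} → All (_< k) w → All LedBySmaller Λ → AvoidsAll w Λ → AvoidsAll (k ∷ k ∷ w) Λ
avoidsAll-∷∷-above {Λ = []} _ _ _ = tt
avoidsAll-∷∷-above {Λ = (a ∷ σ) ∷ Λ} w<k (a<σ ∷ led) (av , avs) =
  avoids-∷∷-above w<k a<σ av , avoidsAll-∷∷-above w<k led avs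

-- An occurrence of 2121 led by k needs a second k preceded by a smaller letter.
avoids2121-∷∷-above : All (_< k) w → Avoids w (2 ∷ 1 ∷ 2 ∷ 1 ∷ []) → Avoids (k ∷ k ∷ w) (2 ∷ 1 ∷ 2 ∷ 1 ∷ [])
avoids2121-∷∷-above {k} {w} w<k av = Sum.[ avoids-k∷w , led-by-k ]′ ∘ Contains-∷⁻
  where
    led-by-k : (∃ λ s → s ⊆ k ∷ w × Pointwise (λ u b → SameRel k u 2 b) s (1 ∷ 2 ∷ 1 ∷ [])) → ⊥
    led-by-k (_ ∷ _ ∷ _ , s⊆ , _ ∷ r ∷ _) =
      <-irrefl (sym (from (proj₁ r) refl)) (All.lookup w<k (lookup (∷⁻ s⊆) (here refl)))

    avoids-k∷w : Avoids (k ∷ w) (2 ∷ 1 ∷ 2 ∷ 1 ∷ [])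
    avoids-k∷w = Sum.[ av , (λ (s , s⊆w , pw) → led-by-k (s , k ∷ʳ s⊆w , pw)) ]′ ∘ Contains-∷⁻

avoiders₂ : List (List ℕ)
avoiders₂ = (1 ∷ 1 ∷ 2 ∷ 2 ∷ []) ∷ (1 ∷ 2 ∷ 2 ∷ 1 ∷ []) ∷ (2 ∷ 1 ∷ 1 ∷ 2 ∷ []) ∷ (2 ∷ 2 ∷ 1 ∷ 1 ∷ []) ∷ []

avoiders₂-sound : All (QSA 2) avoiders₂
avoiders₂-sound = toWitness {a? = All.all? (quasiStirlingAvoiding? 2 firstNotLargest) avoiders₂} tt

avoiders₂-complete : All (λ π → QSA 2 π → π ∈ avoiders₂) (permutations (doubled 2))
avoiders₂-complete = toWitness
  {a? = All.all? (λ π → quasiStirlingAvoiding? 2 firstNotLargest π →-dec π ∈? avoiders₂) (permutations (doubled 2))} tt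

qsa-∷∷ : QSA n w → QSA (suc n) (suc n ∷ suc n ∷ w)
qsa-∷∷ {n} {w} ((w↭ , av1212 , av2121) , avΛ) =
  ( ↭-trans (prep _ (prep _ w↭)) (↭-sym (doubled-suc↭ n))
  , avoids-∷∷-above w<1+n (here sz<ss) av1212
  , avoids2121-∷∷-above w<1+n av2121 )
  , avoidsAll-∷∷-above w<1+n firstNotLargest-ledBySmaller avΛ
  where
    w<1+n : All (_< suc n) w
    w<1+n = All.tabulate (s≤s ∘ ∈doubled⇒≤ ∘ ∈-resp-↭ w↭)

qsa-∷∷⁻ : 2 ≤ n → QSA (suc n) π → ∃ λ w → π ≡ suc n ∷ suc n ∷ w × QSA n w
qsa-∷∷⁻ {n} 2≤n ((π↭ , av1212 , av2121) , avΛ) with ↭doubled⇒max∷max∷ 2≤n π↭ avΛ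
... | w , refl , w↭ = w , refl , (w↭ , Avoids-⊆ w⊆π av1212 , Avoids-⊆ w⊆π av2121) , AvoidsAll-⊆ w⊆π avΛ
  where
    w⊆π : w ⊆ suc n ∷ suc n ∷ w
    w⊆π = _ ∷ʳ _ ∷ʳ ⊆-refl

∈map-max∷max∷⇔ : ∀ {L} → 2 ≤ n → (∀ w → w ∈ L ⇔ QSA n w) →
  ∀ π → π ∈ map (λ w → suc n ∷ suc n ∷ w) L ⇔ QSA (suc n) π
∈map-max∷max∷⇔ {n} {L} 2≤n ∈L⇔ π = mk⇔ sound complete
  where
    sound : π ∈ map (λ w → suc n ∷ suc n ∷ w) L → QSA (suc n) π
    sound π∈ with ∈-map⁻ _ π∈
    ... | w , w∈L , refl = qsa-∷∷ (to (∈L⇔ w) w∈L)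

    complete : QSA (suc n) π → π ∈ map (λ w → suc n ∷ suc n ∷ w) L
    complete qsa with qsa-∷∷⁻ 2≤n qsa
    ... | w , refl , qsa-w = ∈-map⁺ _ (from (∈L⇔ w) qsa-w)

-- Only meaningful for n ≥ 2.
avoiders : ℕ → List (List ℕ)
avoiders zero = []
avoiders (suc zero) = []
avoiders (suc (suc zero)) = avoiders₂
avoiders (suc n@(suc (suc _))) = map (λ w → suc n ∷ suc n ∷ w) (avoiders n)

∈avoiders⇔ : ∀ m π → π ∈ avoiders (2 + m) ⇔ QSA (2 + m) π
∈avoiders⇔ zero π = mk⇔ (All.lookup avoiders₂-sound) complete
  where
    complete : QSA 2 π → π ∈ avoiders₂
    complete qsa = All.lookup avoiders₂-complete (from (∈permutations⇔↭ _) (proj₁ (proj₁ qsa))) qsa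
∈avoiders⇔ (suc m) = ∈map-max∷max∷⇔ (s≤s (s≤s z≤n)) (∈avoiders⇔ m)

length-avoiders : ∀ m → length (avoiders (2 + m)) ≡ 4
length-avoiders zero = refl
length-avoiders (suc m) = trans (length-map _ (avoiders (2 + m))) (length-avoiders m)

unique-avoiders : ∀ m → Unique (avoiders (2 + m))
unique-avoiders zero = toWitness {a? = unique? avoiders₂} tt
unique-avoiders (suc m) = Unique.map⁺ (proj₂ ∘ ∷-injective ∘ proj₂ ∘ ∷-injective) (unique-avoiders m)

theorem4p15 : (n : ℕ) → 2 ≤ n →
    HasCard (QuasiStirlingAvoiding n
      ((1 ∷ 2 ∷ 3 ∷ []) ∷ (1 ∷ 3 ∷ 2 ∷ []) ∷ (2 ∷ 1 ∷ 3 ∷ []) ∷ (2 ∷ 3 ∷ 1 ∷ []) ∷ [])) 4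
theorem4p15 (suc (suc m)) (s≤s (s≤s z≤n)) =
  avoiders (2 + m) , length-avoiders m , unique-avoiders m , ∈avoiders⇔ m
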